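{- Let $G$ be a finite simple graph with maximum degree $\Delta\ge 2$, with edges ordered as $e_1,\ldots,e_m$. Fix a real $\gamma>1$, let $K=\lceil(2+\gamma)(\Delta-1)\rceil$, $N=\lceil\gamma(\Delta-1)\rceil$, let $t\ge 1$ be an integer, and run the algorithm described in the context on $G$ with an input vector $F\in\{1,\ldots,N\}^t$. Then for each step $i\le t$, the set $X_i$ of edges that are uncolored after step $i$ is uniquely determined by the record $(R_j)_{j\le i}$ (i.e. any two input vectors producing the same record $(R_j)_{j\le i}$ produce the same set $X_i$).
   Context: The algorithm takes as input $F=(F_1,\ldots,F_t)\in\{1,\ldots,N\}^t$ and maintains a partial edge-coloring of $G$ with colors in $\{1,\ldots,K\}$; initially no edge is colored. At step $i$ ($i=1,\ldots,t$), if all edges are colored the algorithm stops; otherwise let $e_j=uv$ be the uncolored edge of smallest index. Let $S'$ be the set of colors that appear, in the current partial coloring, on edges $xy\ne uv$ such that either (1) $x=u$ or $x=v$, or (2) $ux$ and $vy$ are edges of $G$ that are colored and have the same color. Let $S=\{1,\ldots,K\}\setminus S'$ (one has $|S|\ge N$). Color $e_j$ with the $F_i$-th smallest element of $S$. If after this some cycle of $G$ has all its edges colored using only two colors (such a cycle has even length $2k\ge 6$), choose one such cycle $C$, write its edges in cyclic order as $f_1=e_j,f_2,\ldots,f_{2k}$, oriented so that the index of $f_2$ is smaller than the index of $f_{2k}$, and uncolor all edges of $C$ except $f_2$ and $f_3$; set $R_i=(k,\ell)$, where $\ell$ is the position of $C$ in a fixed (e.g. lexicographic) ordering of all cycles of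 length $2k$ of $G$ containing $e_j$. If no such 2-colored cycle is created, $R_i$ is empty. The vector $R=(R_1,\ldots,R_t)$ is the record.
   Formalization: The parameter γ ranges over the rationals greater than 1 rather than over the reals. -}

module Defs where

open import Data.Nat as ℕ using (ℕ; zero; suc; _+_; _∸_; _≤_; _<_)
open import Data.Fin as Fin using (Fin; toℕ; lower₁)
open import Data.Fin.Subset using (Subset)
open import Data.List using (List; length; filter; allFin; lookup)
open import Data.List.Membership.Propositional renaming (_∈_ to _∈ₗ_)
open import Data.List.Relation.Unary.Unique.Propositional using (Unique)
open import Data.Maybe using (Maybe; just; nothing)
open import Data.Product using (Σ; ∃; ∃-syntax; _×_; _,_; proj₁; proj₂)
open import Data.Sum using (_⊎_; inj₁; inj₂)
open import Function using (Injective; _⇔_)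
open import Relation.Binary.PropositionalEquality using (_≡_; _≢_)
open import Relation.Nullary using (¬_)
open import Relation.Unary using (Decidable)
import Data.Sum.Relation.Unary.All as SumAll
open import Relation.Nullary.Decidable using (_⊎-dec_)

-- Finite simple graphs with an ordered edge list e_0, …, e_{m-1}
-- (edge e_j of the paper is the index j-1 here; "smaller index" is
-- compared via toℕ).

record Graph : Set where
  field
    n        : ℕ
    m        : ℕ
    ends     : Fin m → Fin n × Fin n
    loopless : ∀ e → proj₁ (ends e) ≢ proj₂ (ends e)
    simple   : ∀ e e' → (ends e ≡ ends e' ⊎
                         (proj₁ (ends e) ≡ proj₂ (ends e') × proj₂ (ends e) ≡ proj₁ (ends e')))
                      → e ≡ e'

module _ (G : Graph) where
  open Graph G

  Joins : Fin m → Fin n → Fin n → Set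
  Joins e x y = ends e ≡ (x , y) ⊎ ends e ≡ (y , x)

  Incident : Fin n → Fin m → Set
  Incident v e = proj₁ (ends e) ≡ v ⊎ proj₂ (ends e) ≡ v

  incident? : (v : Fin n) → Decidable (Incident v)
  incident? v e = (proj₁ (ends e) Fin.≟ v) ⊎-dec (proj₂ (ends e) Fin.≟ v)

  degree : Fin n → ℕ
  degree v = length (filter (incident? v) (allFin m))

  MaxDegree : ℕ → Set
  MaxDegree Δ = (∀ v → degree v ≤ Δ) × (∃[ v ] degree v ≡ Δ)

  -- Cycles.  A cycle of length 3 + r is a cyclic sequence of distinct
  -- vertices w_0 … w_{2+r} together with the edges f_i joining w_i and
  -- w_{i+1 mod (3+r)}.

  next : ∀ {L} → Fin L → Fin L
  next {suc l} i with l ℕ.≟ toℕ i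
  ... | Relation.Nullary.yes _ = Fin.zero
  ... | Relation.Nullary.no ne = Fin.suc (lower₁ i ne)

  record Cycle (r : ℕ) : Set where
    field
      verts     : Fin (3 + r) → Fin n
      verts-inj : Injective _≡_ _≡_ verts
      edgs      : Fin (3 + r) → Fin m
      joins     : ∀ i → Joins (edgs i) (verts i) (verts (next i))

  open Cycle public

  InCycle : ∀ {r} → Cycle r → Fin m → Set
  InCycle C e = ∃[ i ] edgs C i ≡ e

  EdgeSetOf : ∀ {r} → Cycle r → Subset m → Set
  EdgeSetOf C s = ∀ e → (e Data.Fin.Subset.∈ s) ⇔ InCycle C e

  -- A fixed ordering of all cycles (as edge sets) of length 2k that
  -- contain the edge e: a duplicate-free list containing exactly them.
  CycleOrdering : (Fin m → ℕ → List (Subset m)) → Set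
  CycleOrdering ord =
    ∀ e k → Unique (ord e k) ×
      (∀ s → s ∈ₗ ord e k ⇔
        (∃[ r ] Σ (Cycle r) λ C → (3 + r ≡ k + k) × InCycle C e × EdgeSetOf C s))

  -- Partial edge colourings (colours are natural numbers; nothing =
  -- uncoloured).

  Colouring : Set
  Colouring = Fin m → Maybe ℕ

  empty : Colouring
  empty _ = nothing

  AllColoured : Colouring → Set
  AllColoured col = ∀ e → col e ≢ nothing

  FirstUncoloured : Colouring → Fin m → Set
  FirstUncoloured col e = col e ≡ nothing × (∀ e' → toℕ e' < toℕ e → col e' ≢ nothing)

  Forbidden : Colouring → Fin m → ℕ → Set
  Forbidden col e c =
    ∃[ f ] (f ≢ e × col f ≡ just c ×
      ∃[ x ] ∃[ y ] (Joins f x y ×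
        ((x ≡ u ⊎ x ≡ v) ⊎
         (∃[ g ] ∃[ h ] ∃[ c' ] (Joins g u x × Joins h v y × col g ≡ just c' × col h ≡ just c')))))
    where
      u = proj₁ (ends e)
      v = proj₂ (ends e)

  -- c is the F-th smallest (F ≥ 1) element of the set P ⊆ ℕ
  NthSmallest : (ℕ → Set) → ℕ → ℕ → Set
  NthSmallest P zero    c = Data.Empty.⊥ where import Data.Empty
  NthSmallest P (suc f) c =
    Σ (Fin (suc f) → ℕ) λ s →
      (∀ i j → toℕ i < toℕ j → s i < s j) ×
      (∀ i → P (s i)) ×
      s (Fin.fromℕ f) ≡ c ×
      (∀ d → P d → d ≤ c → ∃[ i ] s i ≡ d)

  setColour : Colouring → Fin m → ℕ → Colouring
  setColour col e c f with f Fin.≟ e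
  ... | Relation.Nullary.yes _ = just c
  ... | Relation.Nullary.no _  = col f

  Bichromatic : ∀ {r} → Colouring → Cycle r → Set
  Bichromatic col C = ∃[ a ] ∃[ b ] ∀ i → col (edgs C i) ≡ just a ⊎ col (edgs C i) ≡ just b

  -- One step of the algorithm with parameter K, input value Fi:
  --   Step K Fi col col' R   means that from colouring col the step can
  --   produce colouring col' with record entry R (nothing = empty record).
  -- The choice of the bichromatic cycle is nondeterministic (any choice
  -- allowed); the ordering of cycles is the fixed ordering `ord`.

  data Step (K : ℕ) (ord : Fin m → ℕ → List (Subset m)) (Fi : ℕ)
            (col : Colouring) : Colouring → Maybe (ℕ × ℕ) → Set where
    stopped : AllColoured col → Step K ord Fi col col nothing
    noCycle : ∀ e c →
      FirstUncoloured col e →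
      NthSmallest (λ d → 1 ≤ d × d ≤ K × ¬ Forbidden col e d) Fi c →
      (∀ r (C : Cycle r) → ¬ Bichromatic (setColour col e c) C) →
      Step K ord Fi col (setColour col e c) nothing
    cycle : ∀ e c k (ℓ : ℕ) r (C : Cycle r) s (p : Fin (length (ord e k))) col' →
      FirstUncoloured col e →
      NthSmallest (λ d → 1 ≤ d × d ≤ K × ¬ Forbidden col e d) Fi c →
      Bichromatic (setColour col e c) C →
      -- orientation: f_1 = e, index of f_2 < index of f_{2k}
      edgs C Fin.zero ≡ e →
      toℕ (edgs C (Fin.suc Fin.zero)) < toℕ (edgs C (Fin.fromℕ (2 + r))) →
      -- length 3 + r = 2k, and C is the ℓ-th cycle in the fixed ordering
      3 + r ≡ k + k →
      EdgeSetOf C s →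
      lookup (ord e k) p ≡ s →
      toℕ p ≡ ℓ →
      (∀ f → InCycle C f → f ≢ edgs C (Fin.suc Fin.zero) →
             f ≢ edgs C (Fin.suc (Fin.suc Fin.zero)) → col' f ≡ nothing) →
      (∀ f → ¬ (InCycle C f × f ≢ edgs C (Fin.suc Fin.zero) ×
                f ≢ edgs C (Fin.suc (Fin.suc Fin.zero))) →
             col' f ≡ setColour col e c f) →
      Step K ord Fi col col' (just (k , ℓ))

  -- A run of t steps on input F : Fin t → ℕ: states cols 0 … cols t
  -- (cols 0 = empty colouring) and records recs (step i of the paper is
  -- index i-1 here).
  record Run (K t : ℕ) (ord : Fin m → ℕ → List (Subset m)) (F : Fin t → ℕ) : Set where
    field
      cols  : ℕ → Colouring
      recs  : Fin t → Maybe (ℕ × ℕ)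
      init  : cols 0 ≡ empty
      steps : ∀ (i : Fin t) → Step K ord (F i) (cols (toℕ i)) (cols (suc (toℕ i))) (recs i)

  open Run public

-- The edge e_j coloured at step i is the uncoloured edge of smallest index,
-- hence a function of the uncoloured set. If R_i = (k, ℓ), then (e_j, k, ℓ)
-- pins down the edge set of the cycle C via the fixed ordering of cycles.
-- Inside this edge set, f₂ is the one of the two edges meeting f₁ = e_j with
-- the smaller index, and f₃ is the edge other than f₁ meeting f₂. So the set
-- of uncoloured edges after step i is a function of the one before step i and
-- of R_i, and induction on i concludes.
module Submission where

open import Defs
open import Data.Nat using (ℕ; _≤_; _∸_)
open import Data.Integer using (+_)
open import Data.Rational using (ℚ; 1ℚ; _<_; _+_; _*_; _/_; ceiling)
open import Data.Fin using (Fin; toℕ)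
open import Data.Fin.Subset using (Subset)
open import Data.List using (List)
open import Data.Maybe using (nothing)
open import Data.Product using (_×_)
open import Function using (_⇔_)
open import Relation.Binary.PropositionalEquality using (_≡_)
import Data.Nat

open import Data.Nat as ℕ using (suc; zero)
open import Data.Nat.Properties
  using (suc-injective; 0≢1+n; m≢1+n+m; <-cmp; <-asym; m<n⇒m<1+n; n<1+n; <⇒≤)
open import Data.Fin as Fin using (fromℕ; fromℕ<)
open import Data.Fin.Properties using (toℕ-injective; toℕ-fromℕ; toℕ-fromℕ<; toℕ-lower₁; any?)
open import Data.Product using (∃-syntax; _,_; proj₁; proj₂)
open import Data.Sum using (_⊎_; inj₁; inj₂; [_,_])
open import Data.Product.Function.NonDependent.Propositional using (_×-⇔_)
open import Data.Sum.Function.Propositional using (_⊎-⇔_)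
open import Data.Empty using (⊥-elim)
open import Function using (id; mk⇔; Equivalence; Injective)
open import Function.Properties.Equivalence using (⇔-setoid)
open import Relation.Binary using (tri<; tri≈; tri>)
open import Relation.Binary.PropositionalEquality
  using (_≢_; refl; sym; trans; cong; cong-app; subst)
open import Relation.Nullary using (¬_; Dec; yes; no; ¬?)
open import Relation.Nullary.Decidable using (_×-dec_)
import Relation.Binary.Reasoning.Setoid as ≈-Reasoning
open import Level using (0ℓ)
open Equivalence using (to; from)

module _ (G : Graph) where
  open Graph G using (m)

  toℕ-next : ∀ {l} (i : Fin (suc l)) →
    (toℕ i ≡ l × next G i ≡ Fin.zero) ⊎ toℕ (next G i) ≡ suc (toℕ i)
  toℕ-next {l} i with l ℕ.≟ toℕ i
  ... | yes l≡i = inj₁ (sym l≡i , refl)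
  ... | no l≢i  = inj₂ (cong suc (toℕ-lower₁ i l≢i))

  next-fromℕ : ∀ l → next G (fromℕ l) ≡ Fin.zero
  next-fromℕ l with l ℕ.≟ toℕ (fromℕ l)
  ... | yes _   = refl
  ... | no l≢l  = ⊥-elim (l≢l (sym (toℕ-fromℕ l)))

  next-injective : ∀ {L} → Injective _≡_ _≡_ (next G {L})
  next-injective {suc l} {i} {j} eq with toℕ-next i | toℕ-next j
  ... | inj₁ (i≡l , _) | inj₁ (j≡l , _) = toℕ-injective (trans i≡l (sym j≡l))
  ... | inj₁ (_ , i↦0) | inj₂ j↦j+1     = ⊥-elim (0≢1+n (trans (cong toℕ (trans (sym i↦0) eq)) j↦j+1))
  ... | inj₂ i↦i+1     | inj₁ (_ , j↦0) = ⊥-elim (0≢1+n (trans (cong toℕ (trans (sym j↦0) (sym eq))) i↦i+1))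
  ... | inj₂ i↦i+1     | inj₂ j↦j+1     =
    toℕ-injective (suc-injective (trans (sym i↦i+1) (trans (cong toℕ eq) j↦j+1)))

  next²-≢ : ∀ {l} (i : Fin (3 ℕ.+ l)) → next G (next G i) ≢ i
  next²-≢ i eq with toℕ-next i
  ... | inj₁ (i≡last , i↦0) =
    0≢1+n (suc-injective (trans (sym (trans (cong toℕ (sym eq)) (cong (λ k → toℕ (next G k)) i↦0))) i≡last))
  ... | inj₂ i↦i+1 with toℕ-next (next G i)
  ...   | inj₁ (i+1≡last , i+1↦0) =
    0≢1+n (sym (suc-injective (trans (sym i+1≡last) (trans i↦i+1 (cong suc (trans (cong toℕ (sym eq)) (cong toℕ i+1↦0)))))))
  ...   | inj₂ i+1↦i+2 = m≢1+n+m (toℕ i) {1} (trans (cong toℕ (sym eq)) (trans i+1↦i+2 (cong suc i↦i+1)))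

  joins-incidentˡ : ∀ {f x y} → Joins G f x y → Incident G x f
  joins-incidentˡ (inj₁ eq) = inj₁ (cong proj₁ eq)
  joins-incidentˡ (inj₂ eq) = inj₂ (cong proj₂ eq)

  joins-incidentʳ : ∀ {f x y} → Joins G f x y → Incident G y f
  joins-incidentʳ (inj₁ eq) = inj₂ (cong proj₂ eq)
  joins-incidentʳ (inj₂ eq) = inj₁ (cong proj₁ eq)

  incident-joins : ∀ {f x y z} → Joins G f x y → Incident G z f → z ≡ x ⊎ z ≡ y
  incident-joins (inj₁ eq) (inj₁ p) = inj₁ (trans (sym p) (cong proj₁ eq))
  incident-joins (inj₁ eq) (inj₂ p) = inj₂ (trans (sym p) (cong proj₂ eq))
  incident-joins (inj₂ eq) (inj₁ p) = inj₂ (trans (sym p) (cong proj₁ eq))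
  incident-joins (inj₂ eq) (inj₂ p) = inj₁ (trans (sym p) (cong proj₂ eq))

  ShareEndpoint : Fin m → Fin m → Set
  ShareEndpoint f g = ∃[ x ] (Incident G x f × Incident G x g)

  module _ {r} (C : Cycle G r) where

    private
      v = verts C
      e = edgs C

    edgs-injective : Injective _≡_ _≡_ e
    edgs-injective {i} {j} eᵢ≡eⱼ
      with incident-joins (joins C j) (subst (Incident G (v i)) eᵢ≡eⱼ (joins-incidentˡ (joins C i)))
         | incident-joins (joins C j) (subst (Incident G (v (next G i))) eᵢ≡eⱼ (joins-incidentʳ (joins C i)))
    ... | inj₁ vᵢ≡vⱼ | _ = verts-inj C vᵢ≡vⱼ
    ... | inj₂ _ | inj₂ vᵢ₊₁≡vⱼ₊₁ = next-injective (verts-inj C vᵢ₊₁≡vⱼ₊₁)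
    ... | inj₂ vᵢ≡vⱼ₊₁ | inj₁ vᵢ₊₁≡vⱼ =
      ⊥-elim (next²-≢ j (trans (cong (next G) (sym (verts-inj C vᵢ≡vⱼ₊₁))) (verts-inj C vᵢ₊₁≡vⱼ)))

    edgs-shareEndpoint : ∀ i j → ShareEndpoint (e i) (e j) → i ≡ j ⊎ i ≡ next G j ⊎ next G i ≡ j
    edgs-shareEndpoint i j (x , x∈eᵢ , x∈eⱼ)
      with incident-joins (joins C i) x∈eᵢ | incident-joins (joins C j) x∈eⱼ
    ... | inj₁ x≡vᵢ   | inj₁ x≡vⱼ   = inj₁ (verts-inj C (trans (sym x≡vᵢ) x≡vⱼ))
    ... | inj₁ x≡vᵢ   | inj₂ x≡vⱼ₊₁ = inj₂ (inj₁ (verts-inj C (trans (sym x≡vᵢ) x≡vⱼ₊₁)))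
    ... | inj₂ x≡vᵢ₊₁ | inj₁ x≡vⱼ   = inj₂ (inj₂ (verts-inj C (trans (sym x≡vᵢ₊₁) x≡vⱼ)))
    ... | inj₂ x≡vᵢ₊₁ | inj₂ x≡vⱼ₊₁ = inj₁ (next-injective (verts-inj C (trans (sym x≡vᵢ₊₁) x≡vⱼ₊₁)))

    edgs-next-shareEndpoint : ∀ i → ShareEndpoint (e (next G i)) (e i)
    edgs-next-shareEndpoint i = v (next G i) , joins-incidentˡ (joins C (next G i)) , joins-incidentʳ (joins C i)

    -- f₁ f₂ … f_{2k} of the paper are the edges at indices 0, 1, …, 2 + r.
    f₁ f₂ f₃ f-last : Fin m
    f₁ = e Fin.zero
    f₂ = e (Fin.suc Fin.zero)
    f₃ = e (Fin.suc (Fin.suc Fin.zero))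
    f-last = e (fromℕ (2 ℕ.+ r))

    Oriented : Set
    Oriented = toℕ f₂ ℕ.< toℕ f-last

    neighbour-f₁ : ∀ f → InCycle G C f → f ≢ f₁ → ShareEndpoint f f₁ → f ≡ f₂ ⊎ f ≡ f-last
    neighbour-f₁ f (j , refl) f≢f₁ sh with edgs-shareEndpoint j Fin.zero sh
    ... | inj₁ refl        = ⊥-elim (f≢f₁ refl)
    ... | inj₂ (inj₁ refl) = inj₁ refl
    ... | inj₂ (inj₂ j↦0)  = inj₂ (cong e (next-injective (trans j↦0 (sym (next-fromℕ (2 ℕ.+ r))))))

    neighbour-f₂ : ∀ f → InCycle G C f → f ≢ f₁ → f ≢ f₂ → ShareEndpoint f f₂ → f ≡ f₃
    neighbour-f₂ f (j , refl) f≢f₁ f≢f₂ sh with edgs-shareEndpoint j (Fin.suc Fin.zero) sh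
    ... | inj₁ refl        = ⊥-elim (f≢f₂ refl)
    ... | inj₂ (inj₁ refl) = refl
    ... | inj₂ (inj₂ j↦1)  = ⊥-elim (f≢f₁ (cong e (next-injective j↦1)))

    f₂≢f₁ : f₂ ≢ f₁
    f₂≢f₁ eq with edgs-injective eq
    ... | ()

    f₃≢f₁ : f₃ ≢ f₁
    f₃≢f₁ eq with edgs-injective eq
    ... | ()

    f₃≢f₂ : f₃ ≢ f₂
    f₃≢f₂ eq with edgs-injective eq
    ... | ()

    f₂-shareEndpoint-f₁ : ShareEndpoint f₂ f₁
    f₂-shareEndpoint-f₁ = edgs-next-shareEndpoint Fin.zero

    f₃-shareEndpoint-f₂ : ShareEndpoint f₃ f₂
    f₃-shareEndpoint-f₂ = edgs-next-shareEndpoint (Fin.suc Fin.zero)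

  SameEdges : ∀ {r r'} → Cycle G r → Cycle G r' → Set
  SameEdges C C' = ∀ f → InCycle G C f ⇔ InCycle G C' f

  module _ {r r'} (C : Cycle G r) (C' : Cycle G r') (same : SameEdges C C') (f₁≡f₁' : f₁ C ≡ f₁ C') where

    f₂-unique : Oriented C → Oriented C' → f₂ C ≡ f₂ C'
    f₂-unique f₂<last f₂'<last'
      with neighbour-f₁ C (f₂ C') (from (same _) (_ , refl)) (λ eq → f₂≢f₁ C' (trans eq f₁≡f₁'))
             (subst (ShareEndpoint (f₂ C')) (sym f₁≡f₁') (f₂-shareEndpoint-f₁ C'))
         | neighbour-f₁ C' (f₂ C) (to (same _) (_ , refl)) (λ eq → f₂≢f₁ C (trans eq (sym f₁≡f₁')))
             (subst (ShareEndpoint (f₂ C)) f₁≡f₁' (f₂-shareEndpoint-f₁ C))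
    ... | inj₁ f₂'≡f₂ | _ = sym f₂'≡f₂
    ... | inj₂ _ | inj₁ f₂≡f₂' = f₂≡f₂'
    ... | inj₂ f₂'≡last | inj₂ f₂≡last' =
      ⊥-elim (<-asym (subst (toℕ (f₂ C) ℕ.<_) (cong toℕ (sym f₂'≡last)) f₂<last)
                     (subst (toℕ (f₂ C') ℕ.<_) (cong toℕ (sym f₂≡last')) f₂'<last'))

    f₃-unique : f₂ C ≡ f₂ C' → f₃ C ≡ f₃ C'
    f₃-unique f₂≡f₂' = sym (neighbour-f₂ C (f₃ C') (from (same _) (_ , refl))
      (λ eq → f₃≢f₁ C' (trans eq f₁≡f₁')) (λ eq → f₃≢f₂ C' (trans eq f₂≡f₂'))
      (subst (ShareEndpoint (f₃ C')) (sym f₂≡f₂') (f₃-shareEndpoint-f₂ C')))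

  Uncoloured : Colouring G → Fin m → Set
  Uncoloured col f = col f ≡ nothing

  SameUncoloured : Colouring G → Colouring G → Set
  SameUncoloured col col' = ∀ f → Uncoloured col f ⇔ Uncoloured col' f

  setColour-uncoloured : ∀ col e c f → Uncoloured (setColour G col e c) f ⇔ (f ≢ e × Uncoloured col f)
  setColour-uncoloured col e c f with f Fin.≟ e
  ... | yes f≡e = mk⇔ (λ ()) (λ (f≢e , _) → ⊥-elim (f≢e f≡e))
  ... | no f≢e  = mk⇔ (f≢e ,_) proj₂

  setColour-sameUncoloured : ∀ {col col'} e c c' → SameUncoloured col col' →
    SameUncoloured (setColour G col e c) (setColour G col' e c')
  setColour-sameUncoloured {col} {col'} e c c' same f = begin
    Uncoloured (setColour G col e c) f   ≈⟨ setColour-uncoloured col e c f ⟩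
    (f ≢ e × Uncoloured col f)           ≈⟨ mk⇔ id id ×-⇔ same f ⟩
    (f ≢ e × Uncoloured col' f)          ≈⟨ setColour-uncoloured col' e c' f ⟨
    Uncoloured (setColour G col' e c') f ∎
    where open ≈-Reasoning (⇔-setoid 0ℓ)

  firstUncoloured-unique : ∀ {col col' e e'} → FirstUncoloured G col e → FirstUncoloured G col' e' →
    SameUncoloured col col' → e ≡ e'
  firstUncoloured-unique {e = e} {e'} (e-unc , below-e) (e'-unc , below-e') same with <-cmp (toℕ e) (toℕ e')
  ... | tri< e<e' _ _ = ⊥-elim (below-e' e e<e' (to (same e) e-unc))
  ... | tri≈ _ e≡e' _ = toℕ-injective e≡e'
  ... | tri> _ _ e'<e = ⊥-elim (below-e e' e'<e (from (same e') e'-unc))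

  overridden-uncoloured : ∀ (P : Fin m → Set) {col col'} f → Dec (P f) →
    (∀ f → P f → Uncoloured col' f) → (∀ f → ¬ P f → col' f ≡ col f) →
    Uncoloured col' f ⇔ (P f ⊎ Uncoloured col f)
  overridden-uncoloured _ f (yes Pf) cleared kept = mk⇔ (λ _ → inj₁ Pf) (λ _ → cleared f Pf)
  overridden-uncoloured _ f (no ¬Pf) cleared kept =
    mk⇔ (λ u → inj₂ (trans (sym (kept f ¬Pf)) u)) [ (λ Pf → ⊥-elim (¬Pf Pf)) , trans (kept f ¬Pf) ]

  Cleared : ∀ {r} → Cycle G r → Fin m → Set
  Cleared C f = InCycle G C f × f ≢ f₂ C × f ≢ f₃ C

  cleared? : ∀ {r} (C : Cycle G r) f → Dec (Cleared C f)
  cleared? C f = any? (λ i → edgs C i Fin.≟ f) ×-dec ¬? (f Fin.≟ f₂ C) ×-dec ¬? (f Fin.≟ f₃ C)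

  cleared-cong : ∀ {r r'} (C : Cycle G r) (C' : Cycle G r') → SameEdges C C' →
    f₂ C ≡ f₂ C' → f₃ C ≡ f₃ C' → ∀ f → Cleared C f ⇔ Cleared C' f
  cleared-cong _ _ same f₂≡f₂' f₃≡f₃' f = mk⇔
    (λ (f∈C , f≢f₂ , f≢f₃) → to (same f) f∈C , (λ eq → f≢f₂ (trans eq (sym f₂≡f₂'))) , (λ eq → f≢f₃ (trans eq (sym f₃≡f₃'))))
    (λ (f∈C' , f≢f₂ , f≢f₃) → from (same f) f∈C' , (λ eq → f≢f₂ (trans eq f₂≡f₂')) , (λ eq → f≢f₃ (trans eq f₃≡f₃')))

  edgeSetOf-sameEdges : ∀ {r r' s} (C : Cycle G r) (C' : Cycle G r') →
    EdgeSetOf G C s → EdgeSetOf G C' s → SameEdges C C'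
  edgeSetOf-sameEdges _ _ s≡C s≡C' f = mk⇔ (λ f∈C → to (s≡C' f) (from (s≡C f) f∈C)) (λ f∈C' → to (s≡C f) (from (s≡C' f) f∈C'))

  step-sameUncoloured : ∀ {K ord a b col₁ col₂ col₁' col₂' R} →
    Step G K ord a col₁ col₁' R → Step G K ord b col₂ col₂' R →
    SameUncoloured col₁ col₂ → SameUncoloured col₁' col₂'
  step-sameUncoloured (stopped _) (stopped _) same = same
  step-sameUncoloured (stopped all) (noCycle e _ (e-unc , _) _ _) same = ⊥-elim (all e (from (same e) e-unc))
  step-sameUncoloured (noCycle e _ (e-unc , _) _ _) (stopped all) same = ⊥-elim (all e (to (same e) e-unc))
  step-sameUncoloured (noCycle e c first _ _) (noCycle e' c' first' _ _) same
    with refl ← firstUncoloured-unique first first' same = setColour-sameUncoloured e c c' same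
  step-sameUncoloured {col₁ = col₁} {col₂} {col₁'} {col₂'}
    (cycle e c k ℓ r C s p .col₁' first _ _ C₀≡e C-oriented _ s≡C lookup-p≡s p≡ℓ cleared kept)
    (cycle e' c' .k .ℓ r' C' s' p' .col₂' first' _ _ C'₀≡e' C'-oriented _ s'≡C' lookup-p'≡s' p'≡ℓ cleared' kept') same
    with refl ← firstUncoloured-unique first first' same
    with refl ← toℕ-injective (trans p≡ℓ (sym p'≡ℓ))
    with refl ← trans (sym lookup-p≡s) lookup-p'≡s' = λ f → begin
      Uncoloured col₁' f                                 ≈⟨ overridden-uncoloured (Cleared C) f (cleared? C f) (λ f (f∈C , ≢f₂ , ≢f₃) → cleared f f∈C ≢f₂ ≢f₃) kept ⟩
      (Cleared C f ⊎ Uncoloured (setColour G col₁ e c) f) ≈⟨ cleared-cong C C' sameC f₂≡f₂' f₃≡f₃' f ⊎-⇔ setColour-sameUncoloured e c c' same f ⟩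
      (Cleared C' f ⊎ Uncoloured (setColour G col₂ e c') f) ≈⟨ overridden-uncoloured (Cleared C') f (cleared? C' f) (λ f (f∈C' , ≢f₂ , ≢f₃) → cleared' f f∈C' ≢f₂ ≢f₃) kept' ⟨
      Uncoloured col₂' f                                 ∎
    where
      open ≈-Reasoning (⇔-setoid 0ℓ)
      sameC : SameEdges C C'
      sameC = edgeSetOf-sameEdges C C' s≡C s'≡C'
      C₀≡C'₀ : f₁ C ≡ f₁ C'
      C₀≡C'₀ = trans C₀≡e (sym C'₀≡e')
      f₂≡f₂' : f₂ C ≡ f₂ C'
      f₂≡f₂' = f₂-unique C C' sameC C₀≡C'₀ C-oriented C'-oriented
      f₃≡f₃' : f₃ C ≡ f₃ C'
      f₃≡f₃' = f₃-unique C C' sameC C₀≡C'₀ f₂≡f₂'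

  module _ {K t ord} {F F' : Fin t → ℕ} (ρ : Run G K t ord F) (ρ' : Run G K t ord F') where

    run-step-sameUncoloured : (j : Fin t) → recs ρ j ≡ recs ρ' j →
      SameUncoloured (cols ρ (toℕ j)) (cols ρ' (toℕ j)) →
      SameUncoloured (cols ρ (suc (toℕ j))) (cols ρ' (suc (toℕ j)))
    run-step-sameUncoloured j Rⱼ≡Rⱼ' =
      step-sameUncoloured (subst (Step G K ord (F j) _ _) Rⱼ≡Rⱼ' (steps ρ j)) (steps ρ' j)

    run-sameUncoloured : ∀ i → i ≤ t → (∀ (j : Fin t) → toℕ j ℕ.< i → recs ρ j ≡ recs ρ' j) →
      SameUncoloured (cols ρ i) (cols ρ' i)
    run-sameUncoloured zero _ _ f = mk⇔ (λ _ → cong-app (init ρ') f) (λ _ → cong-app (init ρ) f)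
    run-sameUncoloured (suc i) i<t same
      with before ← run-sameUncoloured i (<⇒≤ i<t) (λ j j<i → same j (m<n⇒m<1+n j<i))
      with fromℕ< i<t | toℕ-fromℕ< i<t
    ... | j | refl = run-step-sameUncoloured j (same j (n<1+n (toℕ j))) before

lemma1 : (G : Graph) (Δ : ℕ) → 2 ≤ Δ → MaxDegree G Δ →
    (γ : ℚ) → 1ℚ < γ →
    (K N : ℕ) →
    + K ≡ ceiling ((+ 2 / 1 + γ) * (+ (Δ ∸ 1) / 1)) →
    + N ≡ ceiling (γ * (+ (Δ ∸ 1) / 1)) →
    (ord : Fin (Graph.m G) → ℕ → List (Subset (Graph.m G))) → CycleOrdering G ord →
    (t : ℕ) → 1 ≤ t →
    (F F' : Fin t → ℕ) →
    (∀ i → 1 ≤ F i × F i ≤ N) → (∀ i → 1 ≤ F' i × F' i ≤ N) →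
    (ρ : Run G K t ord F) (ρ' : Run G K t ord F') →
    (i : ℕ) → 1 ≤ i → i ≤ t →
    (∀ (j : Fin t) → toℕ j Data.Nat.< i → recs ρ j ≡ recs ρ' j) →
    ∀ e → (cols ρ i e ≡ nothing) ⇔ (cols ρ' i e ≡ nothing)
lemma1 G _ _ _ _ _ _ _ _ _ _ _ _ _ _ _ _ _ ρ ρ' i _ i≤t same-records =
  run-sameUncoloured G ρ ρ' i i≤t same-records
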